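{- Let $n \ge r \ge 1$ be integers and let $\mathcal{K}_n^r=(V,E)$ be the complete $r$-uniform hypergraph on $n$ vertices, i.e. $|V|=n$ and $E$ is the set of all $r$-element subsets of $V$. Let $k=\lceil n/2\rceil$. Then for every function $f:E\to\{ -1,1\}$ with $\sum_{A\in E} f(A)=0$, \[ X(f)=\min_{v\in V}\Big|\sum_{A\in E,\,A\ni v} f(A)\Big| \;\le\; \frac{\sum_{\ell=0}^r \big|\lceil r/2\rceil-\ell\big|\binom{n-k}{\ell}\binom{k}{r-\ell}}{k}. \] Equivalently, $X(\mathcal{K}_n^r)$ is at most this quantity.
   Context: For a hypergraph $\mathcal{H}=(V,E)$ and $f:E\to\{ -1,1\}$, the unbalancedness is $X(f)=\min_{v\in V}|\sum_{A\ni v} f(A)|$, and $X(\mathcal{H})$ denotes the maximum of $X(f)$ over all $f:E\to\{ -1,1\}$ with $\sum_{A\in E} f(A)=0$. Binomial coefficients $\binom{a}{b}$ are $0$ when $b<0$ or $b>a$. -}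

module Defs where

open import Data.Nat using (ℕ; zero; suc; _+_; _*_; _∸_; _⊓_; ⌈_/2⌉; ∣_-_∣)
open import Data.Nat.Combinatorics using (_C_)
open import Data.Integer as ℤ using (ℤ)
open import Data.Fin using (Fin)
open import Data.Fin.Subset using (Subset; inside; outside; ∣_∣; _∈_)
open import Data.Fin.Subset.Properties using (_∈?_)
open import Data.Vec using ([]; _∷_)
open import Data.List using (List; []; _∷_; map; _++_; filter; upTo)
open import Data.Sign as Sign using (Sign)
open import Data.Nat.Properties using (_≟_)
open import Function using (_∘_)

allSubsets : (n : ℕ) → List (Subset n)
allSubsets zero = [] ∷ []
allSubsets (suc n) = map (outside ∷_) (allSubsets n) ++ map (inside ∷_) (allSubsets n)

edges : (n r : ℕ) → List (Subset n)
edges n r = filter (λ A → ∣ A ∣ ≟ r) (allSubsets n)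

signℤ : Sign → ℤ
signℤ Sign.+ = ℤ.+ 1
signℤ Sign.- = ℤ.-[1+ 0 ]

sumℤ : List ℤ → ℤ
sumℤ [] = ℤ.+ 0
sumℤ (x ∷ xs) = x ℤ.+ sumℤ xs

sumℕ : List ℕ → ℕ
sumℕ [] = 0
sumℕ (x ∷ xs) = x + sumℕ xs

totalSum : (n r : ℕ) → (Subset n → Sign) → ℤ
totalSum n r f = sumℤ (map (signℤ ∘ f) (edges n r))

degree : (n r : ℕ) → (Subset n → Sign) → Fin n → ℤ
degree n r f v = sumℤ (map (signℤ ∘ f) (filter (λ A → v ∈? A) (edges n r)))

-- minimum over Fin n (value 0 for n = 0, which never occurs since n ≥ 1)
minFin : {n : ℕ} → (Fin n → ℕ) → ℕ
minFin {zero} g = 0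
minFin {suc zero} g = g Fin.zero
minFin {suc (suc n)} g = g Fin.zero ⊓ minFin (λ i → g (Fin.suc i))

X : (n r : ℕ) → (Subset n → Sign) → ℕ
X n r f = minFin (λ v → ℤ.∣ degree n r f v ∣)

boundNum : (n r : ℕ) → ℕ
boundNum n r = sumℕ (map term (upTo (suc r)))
  where
  k = ⌈ n /2⌉
  term : ℕ → ℕ
  term ℓ = ∣ ⌈ r /2⌉ - ℓ ∣ * ((n ∸ k) C ℓ) * (k C (r ∸ ℓ))

{-# OPTIONS --safe #-}
-- By pigeonhole, some set S of ⌈n/2⌉ vertices carries degrees of a single sign, so
-- ⌈n/2⌉ X(f) ≤ |Σ_{v ∈ S} deg v| = |Σ_A f(A) |A ∩ S||. As Σ_A f(A) = 0, the weights |A ∩ S|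
-- may be shifted by ⌊r/2⌋ before the triangle inequality, which bounds the sum by
-- Σ_A ||A ∩ S| − ⌊r/2⌋| = Σ_A |⌈r/2⌉ − |A ∖ S||; grouping the r-sets A by ℓ = |A ∖ S|
-- gives the binomial sum.
module Submission where

open import Defs
open import Data.Nat using (ℕ; zero; suc; _+_; _*_; _∸_; _≤_; ⌊_/2⌋; ⌈_/2⌉; ∣_-_∣; z≤n; s≤s)
import Data.Nat.Properties as ℕ
open import Data.Integer as ℤ using (ℤ; 0ℤ; _⊖_)
import Data.Integer.Properties as ℤ
open import Data.Nat.Combinatorics using (_C_; nCk+nC[k+1]≡[n+1]C[k+1])
open import Data.Fin using (Fin)
open import Data.Fin.Subset using (Subset; inside; outside; ∣_∣; _∈_; _∩_; _─_; ∁; ⊥)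
open import Data.Fin.Subset.Properties using (_∈?_; ∉⊥; ∣⊥∣≡0; ∣∁p∣≡n∸∣p∣)
open import Data.Vec using ([]; _∷_; here; there)
open import Data.List using (List; []; _∷_; map; _++_; filter; applyUpTo)
open import Data.List.Properties using (map-++; map-∘; map-cong; map-cong-local)
import Data.List.Relation.Unary.All as All
open import Data.List.Relation.Unary.All.Properties using (all-filter)
open import Data.Bool using (true; false; if_then_else_)
open import Data.Sign using (Sign)
open import Data.Product using (∃-syntax; _×_; _,_)
open import Data.Sum using (_⊎_; inj₁; inj₂)
import Data.Sum as Sum
open import Relation.Nullary using (yes; no; does; ¬_; contradiction)
open import Relation.Unary using (Decidable)
open import Relation.Binary.PropositionalEquality using (_≡_; refl; sym; trans; cong; cong₂; subst; subst₂; module ≡-Reasoning)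
open import Function using (_∘_; id)
open import Data.Nat.Tactic.RingSolver using (solve-∀)
open import Data.Integer.Tactic.RingSolver renaming (solve-∀ to solveℤ-∀)

private
  variable
    n : ℕ
    B : Set

sumℕ-++ : (xs ys : List ℕ) → sumℕ (xs ++ ys) ≡ sumℕ xs + sumℕ ys
sumℕ-++ []       ys = refl
sumℕ-++ (x ∷ xs) ys = trans (cong (x +_) (sumℕ-++ xs ys)) (sym (ℕ.+-assoc x _ _))

sumℕ-zeros : (xs : List B) → sumℕ (map (λ _ → 0) xs) ≡ 0
sumℕ-zeros []       = refl
sumℕ-zeros (_ ∷ xs) = sumℕ-zeros xs

sumℕ-filter : {P : B → Set} (P? : Decidable P) (g : B → ℕ) (xs : List B) →
  sumℕ (map g (filter P? xs)) ≡ sumℕ (map (λ x → if does (P? x) then g x else 0) xs)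
sumℕ-filter P? g []       = refl
sumℕ-filter P? g (x ∷ xs) with does (P? x)
... | true  = cong (g x +_) (sumℕ-filter P? g xs)
... | false = sumℕ-filter P? g xs

sumℤ-filter : {P : B → Set} (P? : Decidable P) (g : B → ℤ) (xs : List B) →
  sumℤ (map g (filter P? xs)) ≡ sumℤ (map (λ x → if does (P? x) then g x else 0ℤ) xs)
sumℤ-filter P? g []       = refl
sumℤ-filter P? g (x ∷ xs) with does (P? x)
... | true  = cong (ℤ._+_ (g x)) (sumℤ-filter P? g xs)
... | false = trans (sumℤ-filter P? g xs) (sym (ℤ.+-identityˡ _))

∣sumℤ∣≤sumℕ∣∣ : (xs : List ℤ) → ℤ.∣ sumℤ xs ∣ ≤ sumℕ (map ℤ.∣_∣ xs)
∣sumℤ∣≤sumℕ∣∣ []       = ℕ.≤-refl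
∣sumℤ∣≤sumℕ∣∣ (x ∷ xs) = ℕ.≤-trans (ℤ.∣i+j∣≤∣i∣+∣j∣ x (sumℤ xs)) (ℕ.+-monoʳ-≤ ℤ.∣ x ∣ (∣sumℤ∣≤sumℕ∣∣ xs))

sumℤ-recentre : (s : B → ℤ) (a : B → ℕ) (c : ℕ) (xs : List B) →
  sumℤ (map (λ x → s x ℤ.* ℤ.+ a x) xs) ≡ sumℤ (map (λ x → s x ℤ.* (a x ⊖ c)) xs) ℤ.+ ℤ.+ c ℤ.* sumℤ (map s xs)
sumℤ-recentre s a c []       = sym (trans (ℤ.+-identityˡ _) (ℤ.*-zeroʳ (ℤ.+ c)))
sumℤ-recentre s a c (x ∷ xs) = begin
  s x ℤ.* ℤ.+ a x ℤ.+ sumℤ (map (λ x → s x ℤ.* ℤ.+ a x) xs)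
    ≡⟨ cong (ℤ._+_ (s x ℤ.* ℤ.+ a x)) (sumℤ-recentre s a c xs) ⟩
  s x ℤ.* ℤ.+ a x ℤ.+ (R ℤ.+ ℤ.+ c ℤ.* T)
    ≡⟨ regroup (s x) (ℤ.+ a x) (ℤ.+ c) R T ⟩
  s x ℤ.* (ℤ.+ a x ℤ.- ℤ.+ c) ℤ.+ R ℤ.+ ℤ.+ c ℤ.* (s x ℤ.+ T)
    ≡⟨ cong (λ u → s x ℤ.* u ℤ.+ R ℤ.+ ℤ.+ c ℤ.* (s x ℤ.+ T)) (ℤ.[+m]-[+n]≡m⊖n (a x) c) ⟩
  s x ℤ.* (a x ⊖ c) ℤ.+ R ℤ.+ ℤ.+ c ℤ.* (s x ℤ.+ T) ∎
  where
  open ≡-Reasoning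
  R = sumℤ (map (λ x → s x ℤ.* (a x ⊖ c)) xs)
  T = sumℤ (map s xs)
  regroup : ∀ σ α γ R T → σ ℤ.* α ℤ.+ (R ℤ.+ γ ℤ.* T) ≡ σ ℤ.* (α ℤ.- γ) ℤ.+ R ℤ.+ γ ℤ.* (σ ℤ.+ T)
  regroup = solveℤ-∀

sumℤ-recentre-balanced : (s : B → ℤ) (a : B → ℕ) (c : ℕ) (xs : List B) → sumℤ (map s xs) ≡ 0ℤ →
  sumℤ (map (λ x → s x ℤ.* ℤ.+ a x) xs) ≡ sumℤ (map (λ x → s x ℤ.* (a x ⊖ c)) xs)
sumℤ-recentre-balanced s a c xs Σs≡0 = begin
  sumℤ (map (λ x → s x ℤ.* ℤ.+ a x) xs)         ≡⟨ sumℤ-recentre s a c xs ⟩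
  Σ[a-c] ℤ.+ ℤ.+ c ℤ.* sumℤ (map s xs)          ≡⟨ cong (λ t → Σ[a-c] ℤ.+ ℤ.+ c ℤ.* t) Σs≡0 ⟩
  Σ[a-c] ℤ.+ ℤ.+ c ℤ.* 0ℤ                       ≡⟨ cong (ℤ._+_ Σ[a-c]) (ℤ.*-zeroʳ (ℤ.+ c)) ⟩
  Σ[a-c] ℤ.+ 0ℤ                                 ≡⟨ ℤ.+-identityʳ Σ[a-c] ⟩
  Σ[a-c]                                        ∎
  where
  open ≡-Reasoning
  Σ[a-c] = sumℤ (map (λ x → s x ℤ.* (a x ⊖ c)) xs)

sumOver : Subset n → (Fin n → ℤ) → ℤ
sumOver []            d = 0ℤ
sumOver (inside  ∷ S) d = d Fin.zero ℤ.+ sumOver S (d ∘ Fin.suc)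
sumOver (outside ∷ S) d = sumOver S (d ∘ Fin.suc)

sumOver-cong : (S : Subset n) {d e : Fin n → ℤ} → (∀ v → d v ≡ e v) → sumOver S d ≡ sumOver S e
sumOver-cong []            d≗e = refl
sumOver-cong (inside  ∷ S) d≗e = cong₂ ℤ._+_ (d≗e Fin.zero) (sumOver-cong S (d≗e ∘ Fin.suc))
sumOver-cong (outside ∷ S) d≗e = sumOver-cong S (d≗e ∘ Fin.suc)

sumOver-0 : (S : Subset n) → sumOver S (λ _ → 0ℤ) ≡ 0ℤ
sumOver-0 []            = refl
sumOver-0 (inside  ∷ S) = trans (ℤ.+-identityˡ _) (sumOver-0 S)
sumOver-0 (outside ∷ S) = sumOver-0 S

sumOver-+ : (S : Subset n) (d e : Fin n → ℤ) → sumOver S (λ v → d v ℤ.+ e v) ≡ sumOver S d ℤ.+ sumOver S e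
sumOver-+ []            d e = refl
sumOver-+ (inside  ∷ S) d e = trans (cong (ℤ._+_ (d Fin.zero ℤ.+ e Fin.zero)) (sumOver-+ S (d ∘ Fin.suc) (e ∘ Fin.suc)))
                                    (interchange (d Fin.zero) (e Fin.zero) _ _)
  where
  interchange : ∀ a b x y → a ℤ.+ b ℤ.+ (x ℤ.+ y) ≡ a ℤ.+ x ℤ.+ (b ℤ.+ y)
  interchange = solveℤ-∀
sumOver-+ (outside ∷ S) d e = sumOver-+ S (d ∘ Fin.suc) (e ∘ Fin.suc)

sumOver-neg : (S : Subset n) (d : Fin n → ℤ) → sumOver S (λ v → ℤ.- d v) ≡ ℤ.- sumOver S d
sumOver-neg []            d = refl
sumOver-neg (inside  ∷ S) d = trans (cong (ℤ._+_ (ℤ.- d Fin.zero)) (sumOver-neg S (d ∘ Fin.suc)))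
                                    (sym (ℤ.neg-distrib-+ (d Fin.zero) _))
sumOver-neg (outside ∷ S) d = sumOver-neg S (d ∘ Fin.suc)

sumOver-indicator : (S A : Subset n) (c : ℤ) →
  sumOver S (λ v → if does (v ∈? A) then c else 0ℤ) ≡ c ℤ.* ℤ.+ ∣ A ∩ S ∣
sumOver-indicator []            []            c = sym (ℤ.*-zeroʳ c)
sumOver-indicator (inside  ∷ S) (inside  ∷ A) c = begin
  c ℤ.+ sumOver S _                  ≡⟨ cong (ℤ._+_ c) (sumOver-indicator S A c) ⟩
  c ℤ.+ c ℤ.* ℤ.+ ∣ A ∩ S ∣          ≡⟨ cong (ℤ._+ c ℤ.* ℤ.+ ∣ A ∩ S ∣) (sym (ℤ.*-identityʳ c)) ⟩
  c ℤ.* ℤ.+ 1 ℤ.+ c ℤ.* ℤ.+ ∣ A ∩ S ∣ ≡⟨ ℤ.*-distribˡ-+ c (ℤ.+ 1) (ℤ.+ ∣ A ∩ S ∣) ⟨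
  c ℤ.* ℤ.+ suc ∣ A ∩ S ∣            ∎
  where open ≡-Reasoning
sumOver-indicator (inside  ∷ S) (outside ∷ A) c = trans (ℤ.+-identityˡ _) (sumOver-indicator S A c)
sumOver-indicator (outside ∷ S) (inside  ∷ A) c = sumOver-indicator S A c
sumOver-indicator (outside ∷ S) (outside ∷ A) c = sumOver-indicator S A c

sumOver-≥ : (S : Subset n) (d : Fin n → ℤ) (x : ℕ) →
  (∀ {v} → v ∈ S → ℤ.+ x ℤ.≤ d v) → ℤ.+ (∣ S ∣ * x) ℤ.≤ sumOver S d
sumOver-≥ []            d x x≤d = ℤ.≤-refl
sumOver-≥ (inside  ∷ S) d x x≤d = subst (ℤ._≤ sumOver (inside ∷ S) d) (sym (ℤ.pos-+ x (∣ S ∣ * x)))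
  (ℤ.+-mono-≤ (x≤d here) (sumOver-≥ S (d ∘ Fin.suc) x (x≤d ∘ there)))
sumOver-≥ (outside ∷ S) d x x≤d = sumOver-≥ S (d ∘ Fin.suc) x (x≤d ∘ there)

double-counting : (S : Subset n) (g : Subset n → ℤ) (As : List (Subset n)) →
  sumOver S (λ v → sumℤ (map g (filter (v ∈?_) As))) ≡ sumℤ (map (λ A → g A ℤ.* ℤ.+ ∣ A ∩ S ∣) As)
double-counting S g As = trans (sumOver-cong S (λ v → sumℤ-filter (v ∈?_) g As)) (swap As)
  where
  swap : ∀ As → sumOver S (λ v → sumℤ (map (λ A → if does (v ∈? A) then g A else 0ℤ) As))
              ≡ sumℤ (map (λ A → g A ℤ.* ℤ.+ ∣ A ∩ S ∣) As)
  swap []       = sumOver-0 S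
  swap (A ∷ As) = trans (sumOver-+ S _ _) (cong₂ ℤ._+_ (sumOver-indicator S A (g A)) (swap As))

SubsetOfSize : ℕ → (Fin n → Set) → Set
SubsetOfSize {n} a P = ∃[ S ] ∣ S ∣ ≡ a × (∀ {v} → v ∈ S → P v)

∅-subset : {P : Fin n → Set} → SubsetOfSize 0 P
∅-subset {n} = ⊥ , ∣⊥∣≡0 n , λ v∈⊥ → contradiction v∈⊥ ∉⊥

insert-zero : ∀ {a} {P : Fin (suc n) → Set} → P Fin.zero → SubsetOfSize a (P ∘ Fin.suc) → SubsetOfSize (suc a) P
insert-zero {P = P} p (S , ∣S∣≡a , S⊆P) = inside ∷ S , cong suc ∣S∣≡a , ∷⊆P
  where
  ∷⊆P : ∀ {v} → v ∈ inside ∷ S → P v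
  ∷⊆P here         = p
  ∷⊆P (there v∈S) = S⊆P v∈S

skip-zero : ∀ {a} {P : Fin (suc n) → Set} → SubsetOfSize a (P ∘ Fin.suc) → SubsetOfSize a P
skip-zero {P = P} (S , ∣S∣≡a , S⊆P) = outside ∷ S , ∣S∣≡a , ∷⊆P
  where
  ∷⊆P : ∀ {v} → v ∈ outside ∷ S → P v
  ∷⊆P (there v∈S) = S⊆P v∈S

pigeonhole : ∀ n {P : Fin n → Set} → Decidable P → ∀ a b → a + b ≤ suc n →
  SubsetOfSize a P ⊎ SubsetOfSize b (λ v → ¬ P v)
pigeonhole n       P? zero    b       _ = inj₁ ∅-subset
pigeonhole n       P? (suc a) zero    _ = inj₂ ∅-subset
pigeonhole zero    P? (suc a) (suc b) (s≤s a+1+b≤0) = contradiction (ℕ.m+n≤o⇒n≤o a a+1+b≤0) λ ()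
pigeonhole (suc n) P? (suc a) (suc b) (s≤s a+1+b≤1+n) with P? Fin.zero
... | yes p  = Sum.map (insert-zero p) skip-zero (pigeonhole n (P? ∘ Fin.suc) a (suc b) a+1+b≤1+n)
... | no ¬p = Sum.map skip-zero (insert-zero ¬p)
                (pigeonhole n (P? ∘ Fin.suc) (suc a) b (subst (_≤ suc n) (ℕ.+-suc a b) a+1+b≤1+n))

minFin≤ : (g : Fin n → ℕ) (v : Fin n) → minFin g ≤ g v
minFin≤ {suc zero}    g Fin.zero    = ℕ.≤-refl
minFin≤ {suc (suc n)} g Fin.zero    = ℕ.m⊓n≤m _ _
minFin≤ {suc (suc n)} g (Fin.suc v) = ℕ.≤-trans (ℕ.m⊓n≤n _ _) (minFin≤ (g ∘ Fin.suc) v)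

⌈n/2⌉+⌈n/2⌉≤1+n : ∀ n → ⌈ n /2⌉ + ⌈ n /2⌉ ≤ suc n
⌈n/2⌉+⌈n/2⌉≤1+n n = ℕ.≤-trans (ℕ.+-monoʳ-≤ ⌈ n /2⌉ (ℕ.⌊n/2⌋≤⌈n/2⌉ (suc n))) (ℕ.≤-reflexive (ℕ.⌊n/2⌋+⌈n/2⌉≡n (suc n)))

+m≤i⇒m≤∣i∣ : ∀ {m i} → ℤ.+ m ℤ.≤ i → m ≤ ℤ.∣ i ∣
+m≤i⇒m≤∣i∣ (ℤ.+≤+ m≤n) = m≤n

≱0⇒+∣i∣≡-i : ∀ {i} → ¬ (0ℤ ℤ.≤ i) → ℤ.+ ℤ.∣ i ∣ ≡ ℤ.- i
≱0⇒+∣i∣≡-i {ℤ.+ m}    i≱0 = contradiction (ℤ.+≤+ z≤n) i≱0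
≱0⇒+∣i∣≡-i {ℤ.-[1+ m ]} _ = refl

heavy-half : (d : Fin n → ℤ) → ∃[ S ] ∣ S ∣ ≡ ⌈ n /2⌉ × ⌈ n /2⌉ * minFin (ℤ.∣_∣ ∘ d) ≤ ℤ.∣ sumOver S d ∣
heavy-half {n} d = Sum.[ nonnegative , negative ]′
  (pigeonhole n (λ v → 0ℤ ℤ.≤? d v) ⌈ n /2⌉ ⌈ n /2⌉ (⌈n/2⌉+⌈n/2⌉≤1+n n))
  where
  x = minFin (ℤ.∣_∣ ∘ d)

  x≤∣d∣ : ∀ v → ℤ.+ x ℤ.≤ ℤ.+ ℤ.∣ d v ∣
  x≤∣d∣ v = ℤ.+≤+ (minFin≤ (ℤ.∣_∣ ∘ d) v)

  nonnegative : SubsetOfSize ⌈ n /2⌉ (λ v → 0ℤ ℤ.≤ d v) → ∃[ S ] ∣ S ∣ ≡ ⌈ n /2⌉ × ⌈ n /2⌉ * x ≤ ℤ.∣ sumOver S d ∣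
  nonnegative (S , ∣S∣≡k , S⊆nonneg) = S , ∣S∣≡k , subst (λ a → a * x ≤ ℤ.∣ sumOver S d ∣) ∣S∣≡k
    (+m≤i⇒m≤∣i∣ (sumOver-≥ S d x λ {v} v∈S → subst (ℤ.+ x ℤ.≤_) (ℤ.0≤i⇒+∣i∣≡i (S⊆nonneg v∈S)) (x≤∣d∣ v)))

  negative : SubsetOfSize ⌈ n /2⌉ (λ v → ¬ 0ℤ ℤ.≤ d v) → ∃[ S ] ∣ S ∣ ≡ ⌈ n /2⌉ × ⌈ n /2⌉ * x ≤ ℤ.∣ sumOver S d ∣
  negative (S , ∣S∣≡k , S⊆neg) = S , ∣S∣≡k , subst₂ (λ a b → a * x ≤ b) ∣S∣≡k ∣Σ-d∣≡∣Σd∣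
    (+m≤i⇒m≤∣i∣ (sumOver-≥ S (ℤ.-_ ∘ d) x λ {v} v∈S → subst (ℤ.+ x ℤ.≤_) (≱0⇒+∣i∣≡-i (S⊆neg v∈S)) (x≤∣d∣ v)))
    where
    ∣Σ-d∣≡∣Σd∣ : ℤ.∣ sumOver S (ℤ.-_ ∘ d) ∣ ≡ ℤ.∣ sumOver S d ∣
    ∣Σ-d∣≡∣Σd∣ = trans (cong ℤ.∣_∣ (sumOver-neg S d)) (ℤ.∣-i∣≡∣i∣ (sumOver S d))

sumBelow : ℕ → (ℕ → ℕ) → ℕ
sumBelow zero    g = 0
sumBelow (suc m) g = g 0 + sumBelow m (g ∘ suc)

sumBelow-cong : ∀ m {g h : ℕ → ℕ} → (∀ ℓ → g ℓ ≡ h ℓ) → sumBelow m g ≡ sumBelow m h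
sumBelow-cong zero    g≗h = refl
sumBelow-cong (suc m) g≗h = cong₂ _+_ (g≗h 0) (sumBelow-cong m (g≗h ∘ suc))

sumBelow-zeros : ∀ m {g : ℕ → ℕ} → (∀ ℓ → g ℓ ≡ 0) → sumBelow m g ≡ 0
sumBelow-zeros zero    g≗0 = refl
sumBelow-zeros (suc m) g≗0 = cong₂ _+_ (g≗0 0) (sumBelow-zeros m (g≗0 ∘ suc))

sumBelow-+ : ∀ m (g h : ℕ → ℕ) → sumBelow m (λ ℓ → g ℓ + h ℓ) ≡ sumBelow m g + sumBelow m h
sumBelow-+ zero    g h = refl
sumBelow-+ (suc m) g h = trans (cong (g 0 + h 0 +_) (sumBelow-+ m (g ∘ suc) (h ∘ suc)))
                               (interchange (g 0) (h 0) (sumBelow m (g ∘ suc)) (sumBelow m (h ∘ suc)))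
  where
  interchange : ∀ a b x y → a + b + (x + y) ≡ a + x + (b + y)
  interchange = solve-∀

sumℕ-applyUpTo : ∀ m (g f : ℕ → ℕ) → sumℕ (map g (applyUpTo f m)) ≡ sumBelow m (g ∘ f)
sumℕ-applyUpTo zero    g f = refl
sumℕ-applyUpTo (suc m) g f = cong (g (f 0) +_) (sumℕ-applyUpTo m g (f ∘ suc))

sumBelow-pascal : ∀ s r (w : ℕ → ℕ) →
  sumBelow (suc r) (λ ℓ → w ℓ * (suc s C (r ∸ ℓ)))
    ≡ sumBelow (suc r) (λ ℓ → w ℓ * (s C (r ∸ ℓ))) + sumBelow r (λ ℓ → w ℓ * (s C (r ∸ suc ℓ)))
sumBelow-pascal s zero    w = sym (ℕ.+-identityʳ _)
sumBelow-pascal s (suc r) w =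
  trans (cong₂ _+_ (cong (w 0 *_) (sym (nCk+nC[k+1]≡[n+1]C[k+1] s r))) (sumBelow-pascal s r (w ∘ suc)))
        (regroup (w 0) (s C r) (s C suc r) _ _)
  where
  regroup : ∀ w a b x y → w * (a + b) + (x + y) ≡ (w * b + x) + (w * a + y)
  regroup = solve-∀

-- For h = 1 this is Vandermonde's sum C(t + s, r).
weightedVandermonde : (ℕ → ℕ) → ℕ → ℕ → ℕ → ℕ
weightedVandermonde h t s r = sumBelow (suc r) (λ ℓ → h ℓ * (t C ℓ) * (s C (r ∸ ℓ)))

weightedVandermonde-0-0 : ∀ h r → weightedVandermonde h 0 0 (suc r) ≡ 0
weightedVandermonde-0-0 h r = sumBelow-zeros (suc (suc r)) vanishes
  where
  vanishes : ∀ ℓ → h ℓ * (0 C ℓ) * (0 C (suc r ∸ ℓ)) ≡ 0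
  vanishes zero    = ℕ.*-zeroʳ (h 0 * 1)
  vanishes (suc ℓ) = cong (_* (0 C (r ∸ ℓ))) (ℕ.*-zeroʳ (h (suc ℓ)))

weightedVandermonde-sucˡ : ∀ h t s r →
  weightedVandermonde h (suc t) s (suc r) ≡ weightedVandermonde h t s (suc r) + weightedVandermonde (h ∘ suc) t s r
weightedVandermonde-sucˡ h t s r =
  trans (cong (h 0 * 1 * (s C suc r) +_) (trans (sumBelow-cong (suc r) pascal) (sumBelow-+ (suc r) miss hit)))
        (sym (ℕ.+-assoc (h 0 * 1 * (s C suc r)) _ _))
  where
  miss hit : ℕ → ℕ
  miss ℓ = h (suc ℓ) * (t C suc ℓ) * (s C (r ∸ ℓ))
  hit  ℓ = h (suc ℓ) * (t C ℓ) * (s C (r ∸ ℓ))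

  pascal : ∀ ℓ → h (suc ℓ) * (suc t C suc ℓ) * (s C (r ∸ ℓ)) ≡ miss ℓ + hit ℓ
  pascal ℓ = trans (cong (λ c → h (suc ℓ) * c * (s C (r ∸ ℓ))) (sym (nCk+nC[k+1]≡[n+1]C[k+1] t ℓ)))
                   (distrib (h (suc ℓ)) (t C ℓ) (t C suc ℓ) (s C (r ∸ ℓ)))
    where
    distrib : ∀ a b c d → a * (b + c) * d ≡ a * c * d + a * b * d
    distrib = solve-∀

weightedVandermonde-sucʳ : ∀ h t s r →
  weightedVandermonde h t (suc s) (suc r) ≡ weightedVandermonde h t s (suc r) + weightedVandermonde h t s r
weightedVandermonde-sucʳ h t s r = sumBelow-pascal s (suc r) (λ ℓ → h ℓ * (t C ℓ))

sumℕ-allSubsets-suc : ∀ n (g : Subset (suc n) → ℕ) →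
  sumℕ (map g (allSubsets (suc n)))
    ≡ sumℕ (map (g ∘ (outside ∷_)) (allSubsets n)) + sumℕ (map (g ∘ (inside ∷_)) (allSubsets n))
sumℕ-allSubsets-suc n g = begin
  sumℕ (map g (map (outside ∷_) (allSubsets n) ++ map (inside ∷_) (allSubsets n)))
    ≡⟨ cong sumℕ (map-++ g (map (outside ∷_) (allSubsets n)) _) ⟩
  sumℕ (map g (map (outside ∷_) (allSubsets n)) ++ map g (map (inside ∷_) (allSubsets n)))
    ≡⟨ sumℕ-++ (map g (map (outside ∷_) (allSubsets n))) _ ⟩
  sumℕ (map g (map (outside ∷_) (allSubsets n))) + sumℕ (map g (map (inside ∷_) (allSubsets n)))
    ≡⟨ cong₂ (λ xs ys → sumℕ xs + sumℕ ys) (map-∘ (allSubsets n)) (map-∘ (allSubsets n)) ⟨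
  sumℕ (map (g ∘ (outside ∷_)) (allSubsets n)) + sumℕ (map (g ∘ (inside ∷_)) (allSubsets n)) ∎
  where open ≡-Reasoning

sumℕ-subsetsOfSize : ∀ {n} (S : Subset n) r (h : ℕ → ℕ) →
  sumℕ (map (λ A → if does (∣ A ∣ ℕ.≟ r) then h ∣ A ─ S ∣ else 0) (allSubsets n))
    ≡ weightedVandermonde h ∣ ∁ S ∣ ∣ S ∣ r
sumℕ-subsetsOfSize []            zero    h = cong (_+ 0) (sym (trans (ℕ.*-identityʳ _) (ℕ.*-identityʳ _)))
sumℕ-subsetsOfSize []            (suc r) h = sym (weightedVandermonde-0-0 h r)
sumℕ-subsetsOfSize {suc n} (outside ∷ S) zero    h =
  trans (sumℕ-allSubsets-suc n _)
        (trans (cong₂ _+_ (sumℕ-subsetsOfSize S zero h) (sumℕ-zeros (allSubsets n))) (ℕ.+-identityʳ _))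
sumℕ-subsetsOfSize {suc n} (outside ∷ S) (suc r) h =
  trans (sumℕ-allSubsets-suc n _)
        (trans (cong₂ _+_ (sumℕ-subsetsOfSize S (suc r) h) (sumℕ-subsetsOfSize S r (h ∘ suc)))
               (sym (weightedVandermonde-sucˡ h ∣ ∁ S ∣ ∣ S ∣ r)))
sumℕ-subsetsOfSize {suc n} (inside  ∷ S) zero    h =
  trans (sumℕ-allSubsets-suc n _)
        (trans (cong₂ _+_ (sumℕ-subsetsOfSize S zero h) (sumℕ-zeros (allSubsets n))) (ℕ.+-identityʳ _))
sumℕ-subsetsOfSize {suc n} (inside  ∷ S) (suc r) h =
  trans (sumℕ-allSubsets-suc n _)
        (trans (cong₂ _+_ (sumℕ-subsetsOfSize S (suc r) h) (sumℕ-subsetsOfSize S r h))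
               (sym (weightedVandermonde-sucʳ h ∣ ∁ S ∣ ∣ S ∣ r)))

sumℕ-edges : ∀ n r (S : Subset n) (h : ℕ → ℕ) →
  sumℕ (map (λ A → h ∣ A ─ S ∣) (edges n r)) ≡ weightedVandermonde h ∣ ∁ S ∣ ∣ S ∣ r
sumℕ-edges n r S h = trans (sumℕ-filter (λ A → ∣ A ∣ ℕ.≟ r) _ (allSubsets n)) (sumℕ-subsetsOfSize S r h)

∣m⊖n∣≡∣m-n∣ : ∀ m n → ℤ.∣ m ⊖ n ∣ ≡ ∣ m - n ∣
∣m⊖n∣≡∣m-n∣ zero    zero    = refl
∣m⊖n∣≡∣m-n∣ zero    (suc n) = refl
∣m⊖n∣≡∣m-n∣ (suc m) zero    = refl
∣m⊖n∣≡∣m-n∣ (suc m) (suc n) = trans (cong ℤ.∣_∣ (ℤ.[1+m]⊖[1+n]≡m⊖n m n)) (∣m⊖n∣≡∣m-n∣ m n)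

∣signℤ*i∣≡∣i∣ : ∀ s i → ℤ.∣ signℤ s ℤ.* i ∣ ≡ ℤ.∣ i ∣
∣signℤ*i∣≡∣i∣ Sign.+ i = cong ℤ.∣_∣ (ℤ.*-identityˡ i)
∣signℤ*i∣≡∣i∣ Sign.- i = trans (cong ℤ.∣_∣ (ℤ.-1*i≡-i i)) (ℤ.∣-i∣≡∣i∣ i)

m+n≡o+p⇒∣m-o∣≡∣p-n∣ : ∀ m n o p → m + n ≡ o + p → ∣ m - o ∣ ≡ ∣ p - n ∣
m+n≡o+p⇒∣m-o∣≡∣p-n∣ m n o p m+n≡o+p = begin
  ∣ m - o ∣         ≡⟨ ℕ.∣m+n-m+o∣≡∣n-o∣ n m o ⟨
  ∣ n + m - n + o ∣ ≡⟨ cong₂ ∣_-_∣ (trans (ℕ.+-comm n m) m+n≡o+p) (ℕ.+-comm n o) ⟩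
  ∣ o + p - o + n ∣ ≡⟨ ℕ.∣m+n-m+o∣≡∣n-o∣ o p n ⟩
  ∣ p - n ∣         ∎
  where open ≡-Reasoning

∣p∩q∣+∣p─q∣≡∣p∣ : (p q : Subset n) → ∣ p ∩ q ∣ + ∣ p ─ q ∣ ≡ ∣ p ∣
∣p∩q∣+∣p─q∣≡∣p∣ []            []            = refl
∣p∩q∣+∣p─q∣≡∣p∣ (inside  ∷ p) (inside  ∷ q) = cong suc (∣p∩q∣+∣p─q∣≡∣p∣ p q)
∣p∩q∣+∣p─q∣≡∣p∣ (inside  ∷ p) (outside ∷ q) = trans (ℕ.+-suc _ _) (cong suc (∣p∩q∣+∣p─q∣≡∣p∣ p q))
∣p∩q∣+∣p─q∣≡∣p∣ (outside ∷ p) (inside  ∷ q) = ∣p∩q∣+∣p─q∣≡∣p∣ p q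
∣p∩q∣+∣p─q∣≡∣p∣ (outside ∷ p) (outside ∷ q) = ∣p∩q∣+∣p─q∣≡∣p∣ p q

∣sumℤ-edges∣≤ : ∀ n r (f : Subset n → Sign) → totalSum n r f ≡ 0ℤ → (S : Subset n) →
  ℤ.∣ sumℤ (map (λ A → signℤ (f A) ℤ.* ℤ.+ ∣ A ∩ S ∣) (edges n r)) ∣
    ≤ weightedVandermonde (λ ℓ → ∣ ⌈ r /2⌉ - ℓ ∣) ∣ ∁ S ∣ ∣ S ∣ r
∣sumℤ-edges∣≤ n r f balanced S = begin
  ℤ.∣ sumℤ (map (λ A → signℤ (f A) ℤ.* ℤ.+ ∣ A ∩ S ∣) E) ∣
    ≡⟨ cong ℤ.∣_∣ (sumℤ-recentre-balanced (signℤ ∘ f) (λ A → ∣ A ∩ S ∣) ⌊ r /2⌋ E balanced) ⟩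
  ℤ.∣ sumℤ (map centred E) ∣
    ≤⟨ ∣sumℤ∣≤sumℕ∣∣ (map centred E) ⟩
  sumℕ (map ℤ.∣_∣ (map centred E))
    ≡⟨ cong sumℕ (trans (sym (map-∘ E)) (map-cong ∣centred∣ E)) ⟩
  sumℕ (map (λ A → ∣ ∣ A ∩ S ∣ - ⌊ r /2⌋ ∣) E)
    ≡⟨ cong sumℕ (map-cong-local (All.map (λ {A} → balance {A}) (all-filter (λ A → ∣ A ∣ ℕ.≟ r) (allSubsets n)))) ⟩
  sumℕ (map (λ A → ∣ ⌈ r /2⌉ - ∣ A ─ S ∣ ∣) E)
    ≡⟨ sumℕ-edges n r S (λ ℓ → ∣ ⌈ r /2⌉ - ℓ ∣) ⟩
  weightedVandermonde (λ ℓ → ∣ ⌈ r /2⌉ - ℓ ∣) ∣ ∁ S ∣ ∣ S ∣ r ∎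
  where
  open ℕ.≤-Reasoning
  E = edges n r

  centred : Subset n → ℤ
  centred A = signℤ (f A) ℤ.* (∣ A ∩ S ∣ ⊖ ⌊ r /2⌋)

  ∣centred∣ : ∀ A → ℤ.∣ centred A ∣ ≡ ∣ ∣ A ∩ S ∣ - ⌊ r /2⌋ ∣
  ∣centred∣ A = trans (∣signℤ*i∣≡∣i∣ (f A) _) (∣m⊖n∣≡∣m-n∣ ∣ A ∩ S ∣ ⌊ r /2⌋)

  balance : ∀ {A} → ∣ A ∣ ≡ r → ∣ ∣ A ∩ S ∣ - ⌊ r /2⌋ ∣ ≡ ∣ ⌈ r /2⌉ - ∣ A ─ S ∣ ∣
  balance {A} ∣A∣≡r = m+n≡o+p⇒∣m-o∣≡∣p-n∣ ∣ A ∩ S ∣ ∣ A ─ S ∣ ⌊ r /2⌋ ⌈ r /2⌉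
    (trans (∣p∩q∣+∣p─q∣≡∣p∣ A S) (trans ∣A∣≡r (sym (ℕ.⌊n/2⌋+⌈n/2⌉≡n r))))

theorem1p1 : (n r : ℕ) → 1 ≤ r → r ≤ n → (f : Subset n → Sign) → totalSum n r f ≡ ℤ.+ 0 → ⌈ n /2⌉ * X n r f ≤ boundNum n r
theorem1p1 n r _ _ f balanced with heavy-half (degree n r f)
... | S , ∣S∣≡k , k*X≤∣Σdeg∣ = begin
  ⌈ n /2⌉ * X n r f                                                    ≤⟨ k*X≤∣Σdeg∣ ⟩
  ℤ.∣ sumOver S (degree n r f) ∣                                       ≡⟨ cong ℤ.∣_∣ (double-counting S (signℤ ∘ f) (edges n r)) ⟩
  ℤ.∣ sumℤ (map (λ A → signℤ (f A) ℤ.* ℤ.+ ∣ A ∩ S ∣) (edges n r)) ∣ ≤⟨ ∣sumℤ-edges∣≤ n r f balanced S ⟩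
  weightedVandermonde h ∣ ∁ S ∣ ∣ S ∣ r                                ≡⟨ cong₂ (λ t s → weightedVandermonde h t s r) ∣∁S∣≡n∸k ∣S∣≡k ⟩
  weightedVandermonde h (n ∸ ⌈ n /2⌉) ⌈ n /2⌉ r                        ≡⟨ sumℕ-applyUpTo (suc r) _ id ⟨
  boundNum n r                                                         ∎
  where
  open ℕ.≤-Reasoning
  h : ℕ → ℕ
  h ℓ = ∣ ⌈ r /2⌉ - ℓ ∣
  ∣∁S∣≡n∸k : ∣ ∁ S ∣ ≡ n ∸ ⌈ n /2⌉
  ∣∁S∣≡n∸k = trans (∣∁p∣≡n∸∣p∣ S) (cong (n ∸_) ∣S∣≡k)
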